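{- Let $\widehat{\mathcal S}\subseteq\{ -1,0,1\}^2\setminus\{(0,0)\}$ be a step set which is symmetric (if $(i,j)\in\widehat{\mathcal S}$ then $(j,i)\in\widehat{\mathcal S}$) and contains neither $(-1,1)$ nor $(1,-1)$. For $(i,j)\in\mathbb Z^2$ and $n\ge 0$ let $c_{i,j}(n)$ be the number of $n$-step walks with steps in $\widehat{\mathcal S}$, starting at $(0,0)$, ending at $(i,j)$ and staying in $\mathcal C=\{(i,j)\in\mathbb Z^2: i\ge 0\text{ or } j\ge 0\}$. Define the formal series $$\widehat L(x,y)=\sum_{n\ge0}\sum_{i\ge 0,\ j\le i-1}c_{i,j}(n)x^iy^jt^n,\qquad \widehat D(x,y)=\sum_{n\ge 0}\sum_{i\ge 0}c_{i,i}(n)x^iy^it^n,\qquad \widehat L_{0- }(y^{ -1})=\sum_{n\ge 0}\sum_{j<0}c_{0,j}(n)y^jt^n,$$ so that $\widehat D(0,0)=\sum_{n\ge0}c_{0,0}(n)t^n$, and let $\widehat K(x,y)=xy\big(t\sum_{(i,j)\in\widehat{\mathcal S}}x^iy^j-1\big)$. For $(i,j)\in\{ -1,0,1\}^2$ let $\delta_{i,j}=1$ if $(i,j)\in\widehat{\mathcal S}$ and $\delta_{i,j}=0$ otherwise. Then $$\widehat K(x,y)\widehat L(x,y)=-\tfrac12xy+txy\big(\delta_{ -1,-1}x^{ -1}y^{ -1}+\delta_{ -1,0}x^{ -1}\big)\widehat L_{0- }(y^{ -1})+\tfrac12t\delta_{ -1,-1}\widehat D(0,0)$$ $$\qquad-xy\Big(-\tfrac12+t\big(\tfrac12(\delta_{1,1}xy+\delta_{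 -1,-1}x^{ -1}y^{ -1})+\delta_{0,-1}y^{ -1}+\delta_{1,0}x\big)\Big)\widehat D(x,y).$$
   Context: All series are formal power series in $t$ whose coefficients are Laurent polynomials in $x,y$; the identity is an identity of such series. -}

module Defs where

open import Data.Bool using (Bool; true; false; if_then_else_; _∧_; _∨_; not)
open import Data.Nat using (ℕ; zero; suc; _∸_) renaming (_≤ᵇ_ to _≤ᵇℕ_)
open import Data.Integer as ℤ using (ℤ; +_; 0ℤ; 1ℤ; -1ℤ; _≤ᵇ_)
open import Data.Integer.Properties using () renaming (_≟_ to _≟ℤ_)
open import Data.Rational as ℚ using (ℚ; 0ℚ; 1ℚ; ½; -½)
open import Data.List using (List; []; _∷_; map; concatMap; foldr; length; filter; _++_)
open import Data.Product using (_×_; _,_; proj₁; proj₂)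
open import Relation.Nullary using (does)
open import Relation.Binary.PropositionalEquality using (_≡_)

data D3 : Set where
  m z p : D3

val : D3 → ℤ
val m = -1ℤ
val z = 0ℤ
val p = 1ℤ

allD3 : List D3
allD3 = m ∷ z ∷ p ∷ []

Dir : Set
Dir = D3 × D3

allDirs : List Dir
allDirs = concatMap (λ a → map (λ b → (a , b)) allD3) allD3

StepSet : Set
StepSet = D3 → D3 → Bool

allB : {A : Set} → (A → Bool) → List A → Bool
allB f [] = true
allB f (x ∷ xs) = f x ∧ allB f xs

_==ℤ_ : ℤ → ℤ → Bool
a ==ℤ b = does (a ≟ℤ b)

Pt : Set
Pt = ℤ × ℤ

inC : Pt → Bool
inC (a , b) = (0ℤ ≤ᵇ a) ∨ (0ℤ ≤ᵇ b)

allSeqs : ℕ → List (List Dir)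
allSeqs zero = [] ∷ []
allSeqs (suc n) = concatMap (λ d → map (d ∷_) (allSeqs n)) allDirs

visits : Pt → List Dir → List Pt
visits _ [] = []
visits (a , b) ((s , r) ∷ w) =
  let q = (a ℤ.+ val s , b ℤ.+ val r) in q ∷ visits q w

endpoint : Pt → List Dir → Pt
endpoint q [] = q
endpoint (a , b) ((s , r) ∷ w) = endpoint (a ℤ.+ val s , b ℤ.+ val r) w

start : Pt
start = (0ℤ , 0ℤ)

isWalk : StepSet → ℤ → ℤ → List Dir → Bool
isWalk S i j w =
  allB (λ d → S (proj₁ d) (proj₂ d)) w
  ∧ allB inC (start ∷ visits start w)
  ∧ (proj₁ (endpoint start w) ==ℤ i)
  ∧ (proj₂ (endpoint start w) ==ℤ j)

c : StepSet → ℕ → ℤ → ℤ → ℕ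
c S n i j = length (filter (λ w → isWalk S i j w ≟b true) (allSeqs n))
  where
  open import Data.Bool.Properties using () renaming (_≟_ to _≟b_)

-- Formal series in t with Laurent-polynomial coefficients in x, y:
-- F n i j is the coefficient of x^i y^j t^n.

Series : Set
Series = ℕ → ℤ → ℤ → ℚ

cQ : ℕ → ℚ
cQ k = + k ℚ./ 1

infixl 6 _⊕_
_⊕_ : Series → Series → Series
(F ⊕ G) n i j = F n i j ℚ.+ G n i j

record Mono : Set where
  constructor mono
  field
    coeff : ℚ
    tdeg  : ℕ
    xdeg  : ℤ
    ydeg  : ℤ

Poly : Set
Poly = List Mono

monoAct : Mono → Series → Series
monoAct (mono a k u v) F n i j =
  if k ≤ᵇℕ n then a ℚ.* F (n ∸ k) (i ℤ.- u) (j ℤ.- v) else 0ℚ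

zeroS : Series
zeroS _ _ _ = 0ℚ

infixl 7 _·_
_·_ : Poly → Series → Series
P · F = foldr (λ q G → monoAct q F ⊕ G) zeroS P

_+P_ : Poly → Poly → Poly
P +P Q = P ++ Q

_*P_ : Poly → Poly → Poly
P *P Q = concatMap (λ { (mono a k u v) →
           map (λ { (mono b l u' v') → mono (a ℚ.* b) (k Data.Nat.+ l) (u ℤ.+ u') (v ℤ.+ v') }) Q }) P

oneS : Series
oneS zero i j = if (i ==ℤ 0ℤ) ∧ (j ==ℤ 0ℤ) then 1ℚ else 0ℚ
oneS (suc _) _ _ = 0ℚ

toS : Poly → Series
toS P = P · oneS

δ : StepSet → D3 → D3 → ℚ
δ S a b = if S a b then 1ℚ else 0ℚ

Lhat : StepSet → Series
Lhat S n i j = if (0ℤ ≤ᵇ i) ∧ (j ≤ᵇ i ℤ.- 1ℤ) then cQ (c S n i j) else 0ℚ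

Dhat : StepSet → Series
Dhat S n i j = if (0ℤ ≤ᵇ i) ∧ (i ==ℤ j) then cQ (c S n i i) else 0ℚ

L0minus : StepSet → Series
L0minus S n i j = if (i ==ℤ 0ℤ) ∧ (j ≤ᵇ -1ℤ) then cQ (c S n 0ℤ j) else 0ℚ

Dhat00 : StepSet → Series
Dhat00 S n i j = if (i ==ℤ 0ℤ) ∧ (j ==ℤ 0ℤ) then cQ (c S n 0ℤ 0ℤ) else 0ℚ

Khat : StepSet → Poly
Khat S = (mono 1ℚ 0 1ℤ 1ℤ ∷ [])
  *P ( ((mono 1ℚ 1 0ℤ 0ℤ ∷ [])
         *P map (λ d → mono 1ℚ 0 (val (proj₁ d)) (val (proj₂ d)))
                (filter (λ d → S (proj₁ d) (proj₂ d) ≟b true) allDirs))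
       +P (mono (ℚ.- 1ℚ) 0 0ℤ 0ℤ ∷ []) )
  where
  open import Data.Bool.Properties using () renaming (_≟_ to _≟b_)

-- t x y ( δ_{-1,-1} x^{-1} y^{-1} + δ_{-1,0} x^{-1} )
coefL0 : StepSet → Poly
coefL0 S = mono (δ S m m) 1 0ℤ 0ℤ ∷ mono (δ S m z) 1 0ℤ 1ℤ ∷ []

coefD00 : StepSet → Poly
coefD00 S = mono (½ ℚ.* δ S m m) 1 0ℤ 0ℤ ∷ []

coefD : StepSet → Poly
coefD S = (mono (ℚ.- 1ℚ) 0 1ℤ 1ℤ ∷ [])
  *P ( mono -½ 0 0ℤ 0ℤ
     ∷ mono (½ ℚ.* δ S p p) 1 1ℤ 1ℤ
     ∷ mono (½ ℚ.* δ S m m) 1 -1ℤ -1ℤ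
     ∷ mono (δ S z m) 1 0ℤ -1ℤ
     ∷ mono (δ S p z) 1 1ℤ 0ℤ
     ∷ [] )

RHS : StepSet → Series
RHS S = toS (mono -½ 0 1ℤ 1ℤ ∷ [])
      ⊕ (coefL0 S · L0minus S)
      ⊕ (coefD00 S · Dhat00 S)
      ⊕ (coefD S · Dhat S)

Symmetric : StepSet → Set
Symmetric S = ∀ a b → S a b ≡ true → S b a ≡ true

module Submission where

-- Let t be the point (i-1, j-1); the factor x y of Khat moves it to (i, j).  In degree
-- k+1 the coefficient of x^i y^j in Khat·Lhat is  Σ_{d ∈ S} L_k(t-d) - L_{k+1}(t), and that
-- of the right-hand side is a finite combination of the coefficients of L0minus, Dhat00
-- and Dhat at the points t-d, plus ½ D_{k+1}(t).  Decomposing walks by their last step,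
--   c_t(k+1) = [t ∈ C] Σ_d δ_d c_{t-d}(k),
-- turns both sides into weighted sums  Σ_d w(d) δ_d c_{t-d}(k)  over the six steps a
-- symmetric step set without (0,0), (-1,1), (1,-1) may contain; the weights only depend on
-- the position of t.  Off the diagonal the two families of weights coincide, a finite
-- check in diagonal coordinates (x, y-x).  On the diagonal they differ by ½ at the pairs
-- of transposed steps (-1,0), (0,-1) and (0,1), (1,0), and these differences cancel since
-- c is symmetric.

open import Defs
open import Algebra.Bundles using (CommutativeRing)
open import Data.Bool using (Bool; true; false; if_then_else_; _∧_; _∨_)
open import Data.Bool.Properties using (∧-zeroʳ; ∧-identityʳ; ∧-comm; ∨-comm) renaming (_≟_ to _≟ᵇ_)
open import Data.Fin using (Fin)
open import Data.Fin.Patterns using (0F; 1F; 2F; 3F; 4F; 5F; 6F; 7F; 8F)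
open import Data.Integer as ℤ using (ℤ; -[1+_]; 0ℤ; 1ℤ; -1ℤ; _≤ᵇ_)
import Data.Integer.Properties as ℤP
import Data.Integer.Tactic.RingSolver as ℤ-Solver
open import Data.List using (List; []; _∷_; map; filter; length; foldr; concatMap; _++_)
import Data.List.Properties as ListP
open import Data.Nat as ℕ using (ℕ; zero; suc; _∸_) renaming (_≤ᵇ_ to _≤ᵇℕ_)
open import Data.Nat.Coprimality using (1-coprimeTo) renaming (sym to coprime-sym)
open import Data.Nat.ListAction using () renaming (sum to sumℕ)
import Data.Nat.Properties as ℕP
open import Data.Product using (Σ; _×_; _,_; proj₁; proj₂; swap)
open import Data.Rational as ℚ using (ℚ; mkℚ; 0ℚ; 1ℚ; ½; -½; _+_; _*_; _-_)
import Data.Rational.Properties as ℚP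
open import Function.Bundles using (mk⇔)
open import Level using (0ℓ)
open import Relation.Binary.PropositionalEquality
open import Relation.Nullary using (yes; no)
open import Relation.Nullary.Decidable using (does-⇔; T?; dec⇒maybe)
open import Tactic.RingSolver using (solve-∀)
import Tactic.RingSolver.Core.AlmostCommutativeRing as ACR
open import Algebra.Properties.Semiring.Sum (CommutativeRing.semiring ℚP.+-*-commutativeRing)
  using (sum; sum-cong-≗; ∑-comm; *-distribˡ-sum)

ℚ-ring : ACR.AlmostCommutativeRing 0ℓ 0ℓ
ℚ-ring = ACR.fromCommutativeRing ℚP.+-*-commutativeRing (λ x → dec⇒maybe (0ℚ ℚP.≟ x))

-- Indicator of a boolean; note that  δ S a b  is  ind (S a b)  by definition.
ind : Bool → ℚ
ind b = if b then 1ℚ else 0ℚ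

ind-∧ : ∀ a b → ind (a ∧ b) ≡ ind a * ind b
ind-∧ true  b = sym (ℚP.*-identityˡ (ind b))
ind-∧ false b = sym (ℚP.*-zeroˡ (ind b))

ind-idem : ∀ b → ind b * ind b ≡ ind b
ind-idem true  = refl
ind-idem false = refl

-- The nine directions, enumerated in the order of allDirs.  Sums over them are
-- kept opaque: they are only ever manipulated through the lemmas of this block.
dir : Fin 9 → Dir
dir 0F = (m , m)
dir 1F = (m , z)
dir 2F = (m , p)
dir 3F = (z , m)
dir 4F = (z , z)
dir 5F = (z , p)
dir 6F = (p , m)
dir 7F = (p , z)
dir 8F = (p , p)

opaque
  Σᵈ : (Dir → ℚ) → ℚ
  Σᵈ h = sum (λ k → h (dir k))

  Σᵈ-cong : ∀ {h h′ : Dir → ℚ} → (∀ d → h d ≡ h′ d) → Σᵈ h ≡ Σᵈ h′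
  Σᵈ-cong eq = sum-cong-≗ (λ k → eq (dir k))

  Σᵈ-scale : ∀ c h → c * Σᵈ h ≡ Σᵈ (λ d → c * h d)
  Σᵈ-scale c h = *-distribˡ-sum c (λ k → h (dir k))

  Σᵈ-swap : ∀ h → Σᵈ (λ d → h (swap d)) ≡ Σᵈ h
  Σᵈ-swap h = permute (h (m , m)) (h (m , z)) (h (m , p)) (h (z , m)) (h (z , z))
                      (h (z , p)) (h (p , m)) (h (p , z)) (h (p , p))
    where
    permute : ∀ a b c d e f g k l →
      a + (d + (g + (b + (e + (k + (c + (f + (l + 0ℚ))))))))
        ≡ a + (b + (c + (d + (e + (f + (g + (k + (l + 0ℚ))))))))
    permute = solve-∀ ℚ-ring

  -- Exchange of two scaled direction sums: the algebra behind decomposing walks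
  -- by their last step instead of their first.
  Σᵈ-exchange : ∀ (x y : ℚ) (a b : Dir → ℚ) (h : Dir → Dir → ℚ) →
    x * Σᵈ (λ d → a d * (y * Σᵈ (λ d′ → b d′ * h d d′)))
      ≡ y * Σᵈ (λ d′ → b d′ * (x * Σᵈ (λ d → a d * h d d′)))
  Σᵈ-exchange x y a b h = begin
    x * Σᵈ (λ d → a d * (y * Σᵈ (λ d′ → b d′ * h d d′)))
      ≡⟨ expand x y a b h ⟩
    Σᵈ (λ d → Σᵈ (λ d′ → x * (a d * (y * (b d′ * h d d′)))))
      ≡⟨ Σᵈ-cong (λ d → Σᵈ-cong (λ d′ → rearrange x y (a d) (b d′) (h d d′))) ⟩
    Σᵈ (λ d → Σᵈ (λ d′ → y * (b d′ * (x * (a d * h d d′)))))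
      ≡⟨ ∑-comm (λ k k′ → y * (b (dir k′) * (x * (a (dir k) * h (dir k) (dir k′))))) ⟩
    Σᵈ (λ d′ → Σᵈ (λ d → y * (b d′ * (x * (a d * h d d′)))))
      ≡⟨ expand y x b a (λ d′ d → h d d′) ⟨
    y * Σᵈ (λ d′ → b d′ * (x * Σᵈ (λ d → a d * h d d′)))
      ∎
    where
    open ≡-Reasoning
    rearrange : ∀ x y a b h → x * (a * (y * (b * h))) ≡ y * (b * (x * (a * h)))
    rearrange = solve-∀ ℚ-ring
    expand : ∀ x y (a b : Dir → ℚ) (h : Dir → Dir → ℚ) →
      x * Σᵈ (λ d → a d * (y * Σᵈ (λ d′ → b d′ * h d d′)))
        ≡ Σᵈ (λ d → Σᵈ (λ d′ → x * (a d * (y * (b d′ * h d d′)))))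
    expand x y a b h =
      trans (Σᵈ-scale x (λ d → a d * (y * Σᵈ (λ d′ → b d′ * h d d′)))) (Σᵈ-cong (λ d →
      trans (cong (λ s → x * (a d * s)) (Σᵈ-scale y (λ d′ → b d′ * h d d′)))
            (trans (cong (x *_) (Σᵈ-scale (a d) (λ d′ → y * (b d′ * h d d′))))
                   (Σᵈ-scale x (λ d′ → a d * (y * (b d′ * h d d′)))))))

  Σᵈ-allDirs : ∀ h → foldr (λ d s → h d + s) 0ℚ allDirs ≡ Σᵈ h
  Σᵈ-allDirs h = refl

add-sub : ∀ x v → (x ℤ.+ v) ℤ.- v ≡ x
add-sub = ℤ-Solver.solve-∀

sub-add : ∀ x v → (x ℤ.- v) ℤ.+ v ≡ x
sub-add = ℤ-Solver.solve-∀

_+ᵈ_ : Pt → Dir → Pt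
(a , b) +ᵈ (s , r) = (a ℤ.+ val s , b ℤ.+ val r)

_-ᵈ_ : Pt → Dir → Pt
(a , b) -ᵈ (s , r) = (a ℤ.- val s , b ℤ.- val r)

_≐_ : Pt → Pt → Bool
q ≐ e = (proj₁ q ==ℤ proj₁ e) ∧ (proj₂ q ==ℤ proj₂ e)

Step : StepSet → Dir → Bool
Step S d = S (proj₁ d) (proj₂ d)

-- w is an S-walk from q to e staying in C; for q = start this is isWalk.
isWalkFrom : StepSet → Pt → Pt → List Dir → Bool
isWalkFrom S q e w =
  allB (Step S) w ∧ allB inC (q ∷ visits q w) ∧ (q′ ≐ e)
  where q′ = endpoint q w

count : {A : Set} → (A → Bool) → List A → ℕ
count P xs = length (filter (λ x → P x ≟ᵇ true) xs)

count-cong : {A : Set} {P Q : A → Bool} → (∀ x → P x ≡ Q x) → ∀ xs → count P xs ≡ count Q xs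
count-cong eq []       = refl
count-cong {Q = Q} eq (x ∷ xs) rewrite eq x with Q x
... | true  = cong suc (count-cong eq xs)
... | false = count-cong eq xs

count-++ : {A : Set} (P : A → Bool) (xs ys : List A) → count P (xs ++ ys) ≡ count P xs ℕ.+ count P ys
count-++ P xs ys = trans (cong length (ListP.filter-++ _ xs ys)) (ListP.length-++ (filter _ xs))

count-concatMap : {A B : Set} (P : A → Bool) (g : B → List A) (ds : List B) →
  count P (concatMap g ds) ≡ sumℕ (map (λ d → count P (g d)) ds)
count-concatMap P g []       = refl
count-concatMap P g (d ∷ ds) =
  trans (count-++ P (g d) (concatMap g ds)) (cong (count P (g d) ℕ.+_) (count-concatMap P g ds))

count-map : {A B : Set} (P : A → Bool) (g : B → A) (xs : List B) → count P (map g xs) ≡ count (λ x → P (g x)) xs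
count-map P g []       = refl
count-map P g (x ∷ xs) with P (g x)
... | true  = cong suc (count-map P g xs)
... | false = count-map P g xs

count-guard : {A : Set} (b : Bool) (P : A → Bool) (xs : List A) →
  count (λ x → b ∧ P x) xs ≡ (if b then count P xs else 0)
count-guard true  P xs = refl
count-guard false P []       = refl
count-guard false P (x ∷ xs) = count-guard false P xs

cQ-normal : ∀ a → cQ a ≡ mkℚ (ℤ.+ a) 0 (coprime-sym (1-coprimeTo a))
cQ-normal a = ℚP.normalize-coprime (coprime-sym (1-coprimeTo a))

cQ-+ : ∀ a b → cQ (a ℕ.+ b) ≡ cQ a + cQ b
cQ-+ a b rewrite cQ-normal a | cQ-normal b | ℕP.*-identityʳ a | ℕP.*-identityʳ b
               | ℤP.+◃n≡+n a | ℤP.+◃n≡+n b = refl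

cQ-guard : ∀ b n → cQ (if b then n else 0) ≡ ind b * cQ n
cQ-guard true  n = sym (ℚP.*-identityˡ (cQ n))
cQ-guard false n = sym (ℚP.*-zeroˡ (cQ n))

cQ-sum : {A : Set} (h : A → ℕ) (ds : List A) →
  cQ (sumℕ (map h ds)) ≡ foldr (λ d s → cQ (h d) + s) 0ℚ ds
cQ-sum h []       = refl
cQ-sum h (d ∷ ds) = trans (cQ-+ (h d) _) (cong (cQ (h d) +_) (cQ-sum h ds))

isWalkFrom-∷ : ∀ S q e d w →
  isWalkFrom S q e (d ∷ w) ≡ inC q ∧ (Step S d ∧ isWalkFrom S (q +ᵈ d) e w)
isWalkFrom-∷ S (a , b) e (s , r) w with inC (a , b) | S s r
... | true  | true  = refl
... | true  | false = refl
... | false | true  = ∧-zeroʳ (allB (Step S) w)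
... | false | false = refl

opaque
  walks : StepSet → ℕ → Pt → Pt → ℚ
  walks S n q e = cQ (length (filter (λ w → isWalkFrom S q e w ≟ᵇ true) (allSeqs n)))

  c≡walks : ∀ S n i j → cQ (c S n i j) ≡ walks S n start (i , j)
  c≡walks S n i j = refl

  walks-zero : ∀ S q e → walks S 0 q e ≡ ind (inC q ∧ (q ≐ e))
  walks-zero S q e with inC q | q ≐ e
  ... | true  | true  = refl
  ... | true  | false = refl
  ... | false | _     = refl

  walks-first : ∀ S n q e →
    walks S (suc n) q e ≡ ind (inC q) * Σᵈ (λ d → ind (Step S d) * walks S n (q +ᵈ d) e)
  walks-first S n q e = begin
    cQ (count W (concatMap (λ d → map (d ∷_) (allSeqs n)) allDirs))
      ≡⟨ cong cQ (count-concatMap W (λ d → map (d ∷_) (allSeqs n)) allDirs) ⟩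
    cQ (sumℕ (map (λ d → count W (map (d ∷_) (allSeqs n))) allDirs))
      ≡⟨ trans (cQ-sum (λ d → count W (map (d ∷_) (allSeqs n))) allDirs) (Σᵈ-allDirs _) ⟩
    Σᵈ (λ d → cQ (count W (map (d ∷_) (allSeqs n))))
      ≡⟨ Σᵈ-cong (λ d → cong cQ (first-step d)) ⟩
    Σᵈ (λ d → cQ (if inC q then (if Step S d then count (isWalkFrom S (q +ᵈ d) e) (allSeqs n) else 0) else 0))
      ≡⟨ Σᵈ-cong (λ d → trans (cQ-guard (inC q) (if Step S d then N d else 0))
                             (cong (ind (inC q) *_) (cQ-guard (Step S d) (N d)))) ⟩
    Σᵈ (λ d → ind (inC q) * (ind (Step S d) * walks S n (q +ᵈ d) e))
      ≡⟨ Σᵈ-scale (ind (inC q)) (λ d → ind (Step S d) * walks S n (q +ᵈ d) e) ⟨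
    ind (inC q) * Σᵈ (λ d → ind (Step S d) * walks S n (q +ᵈ d) e)
      ∎
    where
    open ≡-Reasoning
    W : List Dir → Bool
    W = isWalkFrom S q e
    N : Dir → ℕ
    N d = count (isWalkFrom S (q +ᵈ d) e) (allSeqs n)
    first-step : ∀ d → count W (map (d ∷_) (allSeqs n))
      ≡ (if inC q then (if Step S d then count (isWalkFrom S (q +ᵈ d) e) (allSeqs n) else 0) else 0)
    first-step d = begin
      count W (map (d ∷_) (allSeqs n))
        ≡⟨ count-map W (d ∷_) (allSeqs n) ⟩
      count (λ w → W (d ∷ w)) (allSeqs n)
        ≡⟨ count-cong (isWalkFrom-∷ S q e d) (allSeqs n) ⟩
      count (λ w → inC q ∧ (Step S d ∧ isWalkFrom S (q +ᵈ d) e w)) (allSeqs n)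
        ≡⟨ count-guard (inC q) _ (allSeqs n) ⟩
      (if inC q then count (λ w → Step S d ∧ isWalkFrom S (q +ᵈ d) e w) (allSeqs n) else 0)
        ≡⟨ cong (λ k → if inC q then k else 0) (count-guard (Step S d) _ (allSeqs n)) ⟩
      (if inC q then (if Step S d then count (isWalkFrom S (q +ᵈ d) e) (allSeqs n) else 0) else 0)
        ∎

==ℤ-shift : ∀ x v c → ((x ℤ.+ v) ==ℤ c) ≡ (x ==ℤ (c ℤ.- v))
==ℤ-shift x v c = does-⇔ (mk⇔ (λ eq → trans (sym (add-sub x v)) (cong (ℤ._- v) eq))
                               (λ eq → trans (cong (ℤ._+ v) eq) (sub-add c v)))
                         (x ℤ.+ v ℤP.≟ c) (x ℤP.≟ c ℤ.- v)

≐-shift : ∀ q e d → ((q +ᵈ d) ≐ e) ≡ (q ≐ (e -ᵈ d))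
≐-shift (a , b) (c , f) (s , r) = cong₂ _∧_ (==ℤ-shift a (val s) c) (==ℤ-shift b (val r) f)

≐-sound : ∀ q e → (q ≐ e) ≡ true → q ≡ e
≐-sound (a , b) (c , f) eq with a ℤP.≟ c | b ℤP.≟ f | eq
... | yes a≡c | yes b≡f | _ = cong₂ _,_ a≡c b≡f
... | yes _   | no _    | ()
... | no _    | _       | ()

arrival : ∀ q e d → (inC (q +ᵈ d) ∧ ((q +ᵈ d) ≐ e)) ≡ (inC e ∧ (q ≐ (e -ᵈ d)))
arrival q e d rewrite ≐-shift q e d with q ≐ (e -ᵈ d) in eq
... | true  = cong (λ x → inC x ∧ true) (trans (cong (_+ᵈ d) (≐-sound q (e -ᵈ d) eq)) (back-forth e d))
  where
  back-forth : ∀ e d → (e -ᵈ d) +ᵈ d ≡ e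
  back-forth (c , f) (s , r) = cong₂ _,_ (sub-add c (val s)) (sub-add f (val r))
... | false = trans (∧-zeroʳ (inC (q +ᵈ d))) (sym (∧-zeroʳ (inC e)))

walks-last : ∀ S n q e →
  walks S (suc n) q e ≡ ind (inC e) * Σᵈ (λ d → ind (Step S d) * walks S n q (e -ᵈ d))
walks-last S zero q e = begin
  walks S 1 q e
    ≡⟨ walks-first S 0 q e ⟩
  ind (inC q) * Σᵈ (λ d → ind (Step S d) * walks S 0 (q +ᵈ d) e)
    ≡⟨ Σᵈ-scale (ind (inC q)) (λ d → ind (Step S d) * walks S 0 (q +ᵈ d) e) ⟩
  Σᵈ (λ d → ind (inC q) * (ind (Step S d) * walks S 0 (q +ᵈ d) e))
    ≡⟨ Σᵈ-cong last-step ⟩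
  Σᵈ (λ d → ind (inC e) * (ind (Step S d) * walks S 0 q (e -ᵈ d)))
    ≡⟨ Σᵈ-scale (ind (inC e)) (λ d → ind (Step S d) * walks S 0 q (e -ᵈ d)) ⟨
  ind (inC e) * Σᵈ (λ d → ind (Step S d) * walks S 0 q (e -ᵈ d))
    ∎
  where
  open ≡-Reasoning
  last-step : ∀ d → ind (inC q) * (ind (Step S d) * walks S 0 (q +ᵈ d) e)
                  ≡ ind (inC e) * (ind (Step S d) * walks S 0 q (e -ᵈ d))
  last-step d rewrite walks-zero S (q +ᵈ d) e | walks-zero S q (e -ᵈ d) | arrival q e d =
    exchange-ends (inC q) (inC e) (Step S d) (q ≐ (e -ᵈ d))
    where
    exchange-ends : ∀ x y s b → ind x * (ind s * ind (y ∧ b)) ≡ ind y * (ind s * ind (x ∧ b))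
    exchange-ends x y s b rewrite ind-∧ y b | ind-∧ x b = swap-xy (ind x) (ind y) (ind s) (ind b)
      where
      swap-xy : ∀ x y s b → x * (s * (y * b)) ≡ y * (s * (x * b))
      swap-xy = solve-∀ ℚ-ring
walks-last S (suc n) q e = begin
  walks S (suc (suc n)) q e
    ≡⟨ walks-first S (suc n) q e ⟩
  ind (inC q) * Σᵈ (λ d → ind (Step S d) * walks S (suc n) (q +ᵈ d) e)
    ≡⟨ cong (ind (inC q) *_) (Σᵈ-cong (λ d → cong (ind (Step S d) *_) (walks-last S n (q +ᵈ d) e))) ⟩
  ind (inC q) * Σᵈ (λ d → ind (Step S d) *
                   (ind (inC e) * Σᵈ (λ d′ → ind (Step S d′) * walks S n (q +ᵈ d) (e -ᵈ d′))))
    ≡⟨ Σᵈ-exchange (ind (inC q)) (ind (inC e)) (λ d → ind (Step S d)) (λ d → ind (Step S d))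
                   (λ d d′ → walks S n (q +ᵈ d) (e -ᵈ d′)) ⟩
  ind (inC e) * Σᵈ (λ d′ → ind (Step S d′) *
                   (ind (inC q) * Σᵈ (λ d → ind (Step S d) * walks S n (q +ᵈ d) (e -ᵈ d′))))
    ≡⟨ cong (ind (inC e) *_) (Σᵈ-cong (λ d′ → cong (ind (Step S d′) *_) (walks-first S n q (e -ᵈ d′)))) ⟨
  ind (inC e) * Σᵈ (λ d′ → ind (Step S d′) * walks S (suc n) q (e -ᵈ d′))
    ∎
  where open ≡-Reasoning

walks-swap : ∀ S → (∀ a b → S a b ≡ S b a) → ∀ n q e → walks S n (swap q) (swap e) ≡ walks S n q e
walks-swap S sym-S zero (a , b) (c , f) rewrite walks-zero S (b , a) (f , c) | walks-zero S (a , b) (c , f)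
  = cong ind (cong₂ _∧_ (∨-comm (0ℤ ℤ.≤ᵇ b) (0ℤ ℤ.≤ᵇ a)) (∧-comm (b ==ℤ f) (a ==ℤ c)))
walks-swap S sym-S (suc n) (a , b) e = begin
  walks S (suc n) (b , a) (swap e)
    ≡⟨ walks-first S n (b , a) (swap e) ⟩
  ind (inC (b , a)) * Σᵈ (λ d → ind (Step S d) * walks S n ((b , a) +ᵈ d) (swap e))
    ≡⟨ cong₂ (λ x y → ind x * y) (∨-comm (0ℤ ℤ.≤ᵇ b) (0ℤ ℤ.≤ᵇ a)) (Σᵈ-cong transposed-step) ⟩
  ind (inC (a , b)) * Σᵈ (λ d → ind (Step S (swap d)) * walks S n ((a , b) +ᵈ swap d) e)
    ≡⟨ cong (ind (inC (a , b)) *_) (Σᵈ-swap (λ d → ind (Step S d) * walks S n ((a , b) +ᵈ d) e)) ⟩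
  ind (inC (a , b)) * Σᵈ (λ d → ind (Step S d) * walks S n ((a , b) +ᵈ d) e)
    ≡⟨ walks-first S n (a , b) e ⟨
  walks S (suc n) (a , b) e
    ∎
  where
  open ≡-Reasoning
  transposed-step : ∀ d → ind (Step S d) * walks S n ((b , a) +ᵈ d) (swap e)
                        ≡ ind (Step S (swap d)) * walks S n ((a , b) +ᵈ swap d) e
  transposed-step (s , r) = cong₂ (λ x y → ind x * y) (sym-S s r) (walks-swap S sym-S n (a ℤ.+ val r , b ℤ.+ val s) e)

walks-inside : ∀ S n q e → walks S n q e ≡ ind (inC e) * walks S n q e
walks-inside S zero q e rewrite walks-zero S q e with q ≐ e in eq
... | true  rewrite ≐-sound q e eq | ∧-identityʳ (inC e) = sym (ind-idem (inC e))
... | false rewrite ∧-zeroʳ (inC q) = sym (ℚP.*-zeroʳ (ind (inC e)))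
walks-inside S (suc n) q e rewrite walks-last S n q e =
  trans (cong (_* X) (sym (ind-idem (inC e)))) (ℚP.*-assoc (ind (inC e)) (ind (inC e)) X)
  where X = Σᵈ (λ d → ind (Step S d) * walks S n q (e -ᵈ d))

≤ᵇ-+ : ∀ k l n → ((k ℕ.+ l) ≤ᵇℕ n) ≡ ((k ≤ᵇℕ n) ∧ (l ≤ᵇℕ (n ∸ k)))
≤ᵇ-+ zero    l n       = refl
≤ᵇ-+ (suc k) l zero    = refl
≤ᵇ-+ (suc k) l (suc n) =
  trans (<ᵇ-suc (k ℕ.+ l) n) (trans (≤ᵇ-+ k l n) (cong (_∧ (l ≤ᵇℕ (n ∸ k))) (sym (<ᵇ-suc k n))))
  where
  <ᵇ-suc : ∀ a n → (a ℕ.<ᵇ suc n) ≡ (a ≤ᵇℕ n)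
  <ᵇ-suc zero    n = refl
  <ᵇ-suc (suc a) n = refl

sub-sum : ∀ i u u′ → i ℤ.- (u ℤ.+ u′) ≡ (i ℤ.- u) ℤ.- u′
sub-sum = ℤ-Solver.solve-∀

monoAct-∙ : ∀ a k u v b l u′ v′ F n i j →
  monoAct (mono (a * b) (k ℕ.+ l) (u ℤ.+ u′) (v ℤ.+ v′)) F n i j
    ≡ monoAct (mono a k u v) (monoAct (mono b l u′ v′) F) n i j
monoAct-∙ a k u v b l u′ v′ F n i j rewrite ≤ᵇ-+ k l n with k ≤ᵇℕ n | l ≤ᵇℕ (n ∸ k)
... | false | _     = refl
... | true  | false = sym (ℚP.*-zeroʳ a)
... | true  | true  rewrite sym (ℕP.∸-+-assoc n k l) | sub-sum i u u′ | sub-sum j v v′ = ℚP.*-assoc a b _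

monoAct-⊕ : ∀ q F G n i j → monoAct q (F ⊕ G) n i j ≡ monoAct q F n i j + monoAct q G n i j
monoAct-⊕ (mono a k u v) F G n i j with k ≤ᵇℕ n
... | true  = ℚP.*-distribˡ-+ a _ _
... | false = refl

monoAct-zeroS : ∀ q n i j → monoAct q zeroS n i j ≡ 0ℚ
monoAct-zeroS (mono a k u v) n i j with k ≤ᵇℕ n
... | true  = ℚP.*-zeroʳ a
... | false = refl

·-++ : ∀ P Q F n i j → ((P ++ Q) · F) n i j ≡ (P · F) n i j + (Q · F) n i j
·-++ []      Q F n i j = sym (ℚP.+-identityˡ _)
·-++ (q ∷ P) Q F n i j =
  trans (cong (monoAct q F n i j +_) (·-++ P Q F n i j))
        (sym (ℚP.+-assoc (monoAct q F n i j) ((P · F) n i j) ((Q · F) n i j)))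

·-monomial : ∀ a k u v Q F n i j →
  (((mono a k u v ∷ []) *P Q) · F) n i j ≡ monoAct (mono a k u v) (Q · F) n i j
·-monomial a k u v []                    F n i j = sym (monoAct-zeroS (mono a k u v) n i j)
·-monomial a k u v (mono b l u′ v′ ∷ Q) F n i j = begin
  monoAct (mono (a * b) (k ℕ.+ l) (u ℤ.+ u′) (v ℤ.+ v′)) F n i j + (((mono a k u v ∷ []) *P Q) · F) n i j
    ≡⟨ cong₂ _+_ (monoAct-∙ a k u v b l u′ v′ F n i j) (·-monomial a k u v Q F n i j) ⟩
  monoAct (mono a k u v) (monoAct (mono b l u′ v′) F) n i j + monoAct (mono a k u v) (Q · F) n i j
    ≡⟨ monoAct-⊕ (mono a k u v) (monoAct (mono b l u′ v′) F) (Q · F) n i j ⟨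
  monoAct (mono a k u v) (monoAct (mono b l u′ v′) F ⊕ (Q · F)) n i j
    ∎
  where open ≡-Reasoning

stepMono : Dir → Mono
stepMono d = mono 1ℚ 0 (val (proj₁ d)) (val (proj₂ d))

·-filter : ∀ (P : Dir → Bool) ds F n i j →
  (map stepMono (filter (λ d → P d ≟ᵇ true) ds) · F) n i j
    ≡ foldr (λ d s → ind (P d) * monoAct (stepMono d) F n i j + s) 0ℚ ds
·-filter P []       F n i j = refl
·-filter P (d ∷ ds) F n i j with P d
... | true  = cong₂ _+_ (sym (ℚP.*-identityˡ (monoAct (stepMono d) F n i j))) (·-filter P ds F n i j)
... | false = trans (·-filter P ds F n i j)
                    (sym (trans (cong (_+ rest) (ℚP.*-zeroˡ (monoAct (stepMono d) F n i j))) (ℚP.+-identityˡ rest)))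
  where rest = foldr (λ d s → ind (P d) * monoAct (stepMono d) F n i j + s) 0ℚ ds

at : Series → ℕ → Pt → ℚ
at F n (x , y) = F n x y

-- The factor x y of the kernel moves the coefficient of x^i y^j to the point (i-1, j-1).
target : ℤ → ℤ → Pt
target i j = (i ℤ.- 1ℤ , j ℤ.- 1ℤ)

stepPoly : StepSet → Poly
stepPoly S = map stepMono (filter (λ d → Step S d ≟ᵇ true) allDirs)

kernel-action : ∀ S F n i j →
  (Khat S · F) n i j
    ≡ monoAct (mono 1ℚ 1 0ℤ 0ℤ) (stepPoly S · F) n (i ℤ.- 1ℤ) (j ℤ.- 1ℤ) - at F n (target i j)
kernel-action S F n i j = begin
  (Khat S · F) n i j
    ≡⟨ ·-monomial 1ℚ 0 1ℤ 1ℤ (tSteps +P minusOne) F n i j ⟩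
  1ℚ * ((tSteps +P minusOne) · F) n i′ j′
    ≡⟨ cong (1ℚ *_) (·-++ tSteps minusOne F n i′ j′) ⟩
  1ℚ * ((tSteps · F) n i′ j′ + ((ℚ.- 1ℚ) * F n (i′ ℤ.- 0ℤ) (j′ ℤ.- 0ℤ) + 0ℚ))
    ≡⟨ cong₂ (λ x y → 1ℚ * (x + ((ℚ.- 1ℚ) * y + 0ℚ)))
             (·-monomial 1ℚ 1 0ℤ 0ℤ (stepPoly S) F n i′ j′)
             (cong₂ (F n) (ℤP.+-identityʳ i′) (ℤP.+-identityʳ j′)) ⟩
  1ℚ * (monoAct (mono 1ℚ 1 0ℤ 0ℤ) (stepPoly S · F) n i′ j′ + ((ℚ.- 1ℚ) * F n i′ j′ + 0ℚ))
    ≡⟨ tidy (monoAct (mono 1ℚ 1 0ℤ 0ℤ) (stepPoly S · F) n i′ j′) (F n i′ j′) ⟩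
  monoAct (mono 1ℚ 1 0ℤ 0ℤ) (stepPoly S · F) n i′ j′ - at F n (target i j)
    ∎
  where
  open ≡-Reasoning
  i′ j′ : ℤ
  i′ = i ℤ.- 1ℤ
  j′ = j ℤ.- 1ℤ
  tSteps minusOne : Poly
  tSteps   = (mono 1ℚ 1 0ℤ 0ℤ ∷ []) *P stepPoly S
  minusOne = mono (ℚ.- 1ℚ) 0 0ℤ 0ℤ ∷ []
  tidy : ∀ x y → 1ℚ * (x + ((ℚ.- 1ℚ) * y + 0ℚ)) ≡ x - y
  tidy = solve-∀ ℚ-ring

lhs-coefficient : ∀ S F k i j →
  (Khat S · F) (suc k) i j
    ≡ Σᵈ (λ d → ind (Step S d) * at F k (target i j -ᵈ d)) - at F (suc k) (target i j)
lhs-coefficient S F k i j = trans (kernel-action S F (suc k) i j)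
  (cong (_- at F (suc k) (target i j))
        (trans (cong (1ℚ *_) (trans (·-filter (Step S) allDirs F k (i′ ℤ.- 0ℤ) (j′ ℤ.- 0ℤ)) (Σᵈ-allDirs _)))
               (trans (ℚP.*-identityˡ _) (Σᵈ-cong (λ d → cong (ind (Step S d) *_) (step-term d))))))
  where
  i′ j′ : ℤ
  i′ = i ℤ.- 1ℤ
  j′ = j ℤ.- 1ℤ
  step-term : ∀ d → monoAct (stepMono d) F k (i′ ℤ.- 0ℤ) (j′ ℤ.- 0ℤ) ≡ at F k (target i j -ᵈ d)
  step-term (s , r) = trans (ℚP.*-identityˡ _)
    (cong₂ (F k) (cong (ℤ._- val s) (ℤP.+-identityʳ i′)) (cong (ℤ._- val r) (ℤP.+-identityʳ j′)))

-- In degree 0 the factor t kills the steps and only the constant term -xy acts.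
lhs-coefficient-zero : ∀ S F i j → (Khat S · F) 0 i j ≡ ℚ.- at F 0 (target i j)
lhs-coefficient-zero S F i j = trans (kernel-action S F 0 i j) (ℚP.+-identityˡ (ℚ.- at F 0 (target i j)))

-- [t^(k+1) x^i y^j] of the right-hand side, read off its definition:
-- the coefficient of x^a y^b·F at (i, j) is the coefficient of F at (i-a, j-b).
rhs-coefficient : ∀ S k i j → RHS S (suc k) i j ≡
      δ S m m * L0minus S k (i ℤ.- 0ℤ) (j ℤ.- 0ℤ)
    + δ S m z * L0minus S k (i ℤ.- 0ℤ) (j ℤ.- 1ℤ)
    + ½ * δ S m m * Dhat00 S k (i ℤ.- 0ℤ) (j ℤ.- 0ℤ)
    + ½ * Dhat S (suc k) (i ℤ.- 1ℤ) (j ℤ.- 1ℤ)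
    - ½ * δ S p p * Dhat S k (i ℤ.- ℤ.+ 2) (j ℤ.- ℤ.+ 2)
    - ½ * δ S m m * Dhat S k (i ℤ.- 0ℤ) (j ℤ.- 0ℤ)
    - δ S z m * Dhat S k (i ℤ.- 1ℤ) (j ℤ.- 0ℤ)
    - δ S p z * Dhat S k (i ℤ.- ℤ.+ 2) (j ℤ.- 1ℤ)
rhs-coefficient S k i j =
  shape (δ S m m) (δ S m z) (δ S z m) (δ S p z) (δ S p p)
        (L0minus S k (i ℤ.- 0ℤ) (j ℤ.- 0ℤ)) (L0minus S k (i ℤ.- 0ℤ) (j ℤ.- 1ℤ))
        (Dhat00 S k (i ℤ.- 0ℤ) (j ℤ.- 0ℤ)) (Dhat S (suc k) (i ℤ.- 1ℤ) (j ℤ.- 1ℤ))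
        (Dhat S k (i ℤ.- ℤ.+ 2) (j ℤ.- ℤ.+ 2)) (Dhat S k (i ℤ.- 0ℤ) (j ℤ.- 0ℤ))
        (Dhat S k (i ℤ.- 1ℤ) (j ℤ.- 0ℤ)) (Dhat S k (i ℤ.- ℤ.+ 2) (j ℤ.- 1ℤ))
  where
  shape : ∀ a b c d e L₁ L₂ O G D₁ D₂ D₃ D₄ →
      (0ℚ + (a * L₁ + (b * L₂ + 0ℚ))) + (½ * a * O + 0ℚ)
    + (½ * G + ((ℚ.- 1ℚ) * (½ * e) * D₁ + ((ℚ.- 1ℚ) * (½ * a) * D₂
    + ((ℚ.- 1ℚ) * c * D₃ + ((ℚ.- 1ℚ) * d * D₄ + 0ℚ)))))
    ≡ a * L₁ + b * L₂ + ½ * a * O + ½ * G - ½ * e * D₁ - ½ * a * D₂ - c * D₃ - d * D₄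
  shape = solve-∀ ℚ-ring

rhs-coefficient-zero : ∀ S i j → RHS S 0 i j ≡ ½ * at (Dhat S) 0 (target i j) - ½ * at oneS 0 (target i j)
rhs-coefficient-zero S i j = shape (oneS 0 (i ℤ.- 1ℤ) (j ℤ.- 1ℤ)) (Dhat S 0 (i ℤ.- 1ℤ) (j ℤ.- 1ℤ))
  where
  shape : ∀ O H → (((-½ * O + 0ℚ) + 0ℚ) + 0ℚ) + (½ * H + 0ℚ) ≡ ½ * H - ½ * O
  shape = solve-∀ ℚ-ring

-- Regions of the plane in diagonal coordinates: (x , e) stands for the point (x , x + e).

L? : ℤ × ℤ → Bool
L? (x , e) = (0ℤ ≤ᵇ x) ∧ (e ≤ᵇ -1ℤ)

D? : ℤ × ℤ → Bool
D? (x , e) = (0ℤ ≤ᵇ x) ∧ (e ==ℤ 0ℤ)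

Col? : ℤ × ℤ → Bool
Col? (x , e) = (x ==ℤ 0ℤ) ∧ (e ≤ᵇ -1ℤ)

O? : ℤ × ℤ → Bool
O? (x , e) = (x ==ℤ 0ℤ) ∧ (e ==ℤ 0ℤ)

C? : ℤ × ℤ → Bool
C? (x , e) = (0ℤ ≤ᵇ x) ∨ (0ℤ ≤ᵇ (x ℤ.+ e))

-- diagonal coordinates of the point from which a step d reaches the point (x , e)
_↓_ : ℤ × ℤ → Dir → ℤ × ℤ
(x , e) ↓ (s , r) = (x ℤ.- val s , e ℤ.+ (val s ℤ.- val r))

-- the six directions a step set satisfying the hypotheses may contain
allowed : List Dir
allowed = (m , m) ∷ (m , z) ∷ (z , m) ∷ (z , p) ∷ (p , z) ∷ (p , p) ∷ []

sumOver : List Dir → (Dir → ℚ) → ℚ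
sumOver ds h = foldr (λ d s → h d + s) 0ℚ ds

Σᵃ : (Dir → ℚ) → ℚ
Σᵃ = sumOver allowed

sumOver-cong : ∀ ds {h h′ : Dir → ℚ} → (∀ d → h d ≡ h′ d) → sumOver ds h ≡ sumOver ds h′
sumOver-cong []       eq = refl
sumOver-cong (d ∷ ds) eq = cong₂ _+_ (eq d) (sumOver-cong ds eq)

sumOver-linear : ∀ ds (a b : Dir → ℚ) c → sumOver ds a + c * sumOver ds b ≡ sumOver ds (λ d → a d + c * b d)
sumOver-linear []       a b c = trans (ℚP.+-identityˡ (c * 0ℚ)) (ℚP.*-zeroʳ c)
sumOver-linear (d ∷ ds) a b c =
  trans (regroup (a d) (sumOver ds a) (b d) (sumOver ds b) c) (cong (λ s → (a d + c * b d) + s) (sumOver-linear ds a b c))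
  where
  regroup : ∀ x A y B c → (x + A) + c * (y + B) ≡ (x + c * y) + (A + c * B)
  regroup = solve-∀ ℚ-ring

sumOver-weights : ∀ ds (w w′ X : Dir → ℚ) → map w ds ≡ map w′ ds →
  sumOver ds (λ d → w d * X d) ≡ sumOver ds (λ d → w′ d * X d)
sumOver-weights []       w w′ X eq = refl
sumOver-weights (d ∷ ds) w w′ X eq with ListP.∷-injective eq
... | wd≡w′d , rest = cong₂ (λ x y → x * X d + y) wd≡w′d (sumOver-weights ds w w′ X rest)

Σᵈ-allowed : ∀ h → h (m , p) ≡ 0ℚ → h (z , z) ≡ 0ℚ → h (p , m) ≡ 0ℚ → Σᵈ h ≡ Σᵃ h
Σᵈ-allowed h hmp hzz hpm =
  trans (sym (Σᵈ-allDirs h)) (drop-zeros (h (m , m)) (h (m , z)) (h (z , m)) (h (z , p)) (h (p , z)) (h (p , p)) hmp hzz hpm)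
  where
  drop-zeros : ∀ a b c d e f {x y w} → x ≡ 0ℚ → y ≡ 0ℚ → w ≡ 0ℚ →
    a + (b + (x + (c + (y + (d + (w + (e + (f + 0ℚ)))))))) ≡ a + (b + (c + (d + (e + (f + 0ℚ)))))
  drop-zeros a b c d e f refl refl refl = zeros a b c d e f
    where
    zeros : ∀ a b c d e f →
      a + (b + (0ℚ + (c + (0ℚ + (d + (0ℚ + (e + (f + 0ℚ)))))))) ≡ a + (b + (c + (d + (e + (f + 0ℚ)))))
    zeros = solve-∀ ℚ-ring

-- In the coefficient of the left-hand side at a target point P, the number of
-- walks to the source P ↓ d enters with this weight.
lhsWeight : ℤ × ℤ → Dir → ℚ
lhsWeight P d = ind (L? (P ↓ d)) - ind ((L? P ∧ C? P) ∧ C? (P ↓ d))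

-- the explicit terms of the right-hand side, as weights of the source point Q
explicitWeight : Dir → ℤ × ℤ → ℚ
explicitWeight (m , m) Q = ind (Col? Q) + ½ * ind (O? Q) - ½ * ind (D? Q)
explicitWeight (m , z) Q = ind (Col? Q)
explicitWeight (z , m) Q = ℚ.- ind (D? Q)
explicitWeight (p , z) Q = ℚ.- ind (D? Q)
explicitWeight (p , p) Q = ℚ.- (½ * ind (D? Q))
explicitWeight _       Q = 0ℚ

-- the weights of the right-hand side, including the term ½ D̂ at the target
rhsWeight : ℤ × ℤ → Dir → ℚ
rhsWeight P d = explicitWeight d (P ↓ d) + ½ * ind ((D? P ∧ C? P) ∧ C? (P ↓ d))

-- Off the diagonal, both sides weigh every source point equally: a finite check, since
-- all the tests above only depend on the position of x among -1, 0, 1 and of e among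
-- -1, 0, 1.
weights-off-diagonal : ∀ x e → D? (x , e) ≡ false →
  map (lhsWeight (x , e)) allowed ≡ map (rhsWeight (x , e)) allowed
weights-off-diagonal -[1+ suc n ]       e                  _ = refl
weights-off-diagonal (-[1+ 0 ])         (-[1+ suc k ])     _ = refl
weights-off-diagonal (-[1+ 0 ])         (-[1+ 0 ])         _ = refl
weights-off-diagonal (-[1+ 0 ])         (ℤ.+ 0)            _ = refl
weights-off-diagonal (-[1+ 0 ])         (ℤ.+ 1)            _ = refl
weights-off-diagonal (-[1+ 0 ])         (ℤ.+ suc (suc k))  _ = refl
weights-off-diagonal (ℤ.+ 0)            (-[1+ suc k ])     _ = refl
weights-off-diagonal (ℤ.+ 0)            (-[1+ 0 ])         _ = refl
weights-off-diagonal (ℤ.+ 0)            (ℤ.+ 0)            ()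
weights-off-diagonal (ℤ.+ 0)            (ℤ.+ 1)            _ = refl
weights-off-diagonal (ℤ.+ 0)            (ℤ.+ suc (suc k))  _ = refl
weights-off-diagonal (ℤ.+ 1)            (-[1+ suc k ])     _ = refl
weights-off-diagonal (ℤ.+ 1)            (-[1+ 0 ])         _ = refl
weights-off-diagonal (ℤ.+ 1)            (ℤ.+ 0)            ()
weights-off-diagonal (ℤ.+ 1)            (ℤ.+ 1)            _ = refl
weights-off-diagonal (ℤ.+ 1)            (ℤ.+ suc (suc k))  _ = refl
weights-off-diagonal (ℤ.+ suc (suc n))  (-[1+ suc k ])     _ = refl
weights-off-diagonal (ℤ.+ suc (suc n))  (-[1+ 0 ])         _ = refl
weights-off-diagonal (ℤ.+ suc (suc n))  (ℤ.+ 0)            ()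
weights-off-diagonal (ℤ.+ suc (suc n))  (ℤ.+ 1)            _ = refl
weights-off-diagonal (ℤ.+ suc (suc n))  (ℤ.+ suc (suc k))  _ = refl

diagonalLhs diagonalRhs : Dir → ℚ
diagonalLhs (m , z) = 1ℚ
diagonalLhs (z , p) = 1ℚ
diagonalLhs _       = 0ℚ
diagonalRhs (m , z) = ½
diagonalRhs (z , m) = ½
diagonalRhs (z , p) = ½
diagonalRhs (p , z) = ½
diagonalRhs _       = 0ℚ

weights-on-diagonal : ∀ n →
  map (lhsWeight (ℤ.+ n , 0ℤ)) allowed ≡ map diagonalLhs allowed ×
  map (rhsWeight (ℤ.+ n , 0ℤ)) allowed ≡ map diagonalRhs allowed
weights-on-diagonal zero    = refl , refl
weights-on-diagonal (suc n) = refl , refl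

diagonal-balance : ∀ (X : Dir → ℚ) → X (m , z) ≡ X (z , m) → X (z , p) ≡ X (p , z) →
  Σᵃ (λ d → diagonalLhs d * X d) ≡ Σᵃ (λ d → diagonalRhs d * X d)
diagonal-balance X mz≡zm zp≡pz rewrite mz≡zm | zp≡pz = halves (X (m , m)) (X (z , m)) (X (p , z)) (X (p , p))
  where
  halves : ∀ a b c g →
    0ℚ * a + (1ℚ * b + (0ℚ * b + (1ℚ * c + (0ℚ * c + (0ℚ * g + 0ℚ)))))
      ≡ 0ℚ * a + (½ * b + (½ * b + (½ * c + (½ * c + (0ℚ * g + 0ℚ)))))
  halves = solve-∀ ℚ-ring

≤ᵇ-translate : ∀ a b c → (a ≤ᵇ b) ≡ ((a ℤ.+ c) ≤ᵇ (b ℤ.+ c))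
≤ᵇ-translate a b c = does-⇔
  (mk⇔ (λ a≤b → ℤP.≤⇒≤ᵇ (ℤP.+-monoˡ-≤ c (ℤP.≤ᵇ⇒≤ {a} {b} a≤b)))
       (λ a+c≤b+c → ℤP.≤⇒≤ᵇ (subst₂ ℤ._≤_ (add-sub a c) (add-sub b c)
                              (ℤP.+-monoˡ-≤ (ℤ.- c) (ℤP.≤ᵇ⇒≤ {a ℤ.+ c} {b ℤ.+ c} a+c≤b+c)))))
  (T? (a ≤ᵇ b)) (T? ((a ℤ.+ c) ≤ᵇ (b ℤ.+ c)))

==ℤ-true : ∀ x y → (x ==ℤ y) ≡ true → x ≡ y
==ℤ-true x y eq with x ℤP.≟ y | eq
... | yes x≡y | _ = x≡y
... | no _    | ()

==ℤ-sym : ∀ x y → (x ==ℤ y) ≡ (y ==ℤ x)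
==ℤ-sym x y = does-⇔ (mk⇔ sym sym) (x ℤP.≟ y) (y ℤP.≟ x)

∧-true-right : ∀ a b → (a ∧ b) ≡ true → b ≡ true
∧-true-right true b eq = eq

diag : Pt → ℤ × ℤ
diag (x , y) = (x , y ℤ.- x)

inC-diag : ∀ q → inC q ≡ C? (diag q)
inC-diag (x , y) = cong (λ w → (0ℤ ≤ᵇ x) ∨ (0ℤ ≤ᵇ w)) (sym (add-offset x y))
  where
  add-offset : ∀ x y → x ℤ.+ (y ℤ.- x) ≡ y
  add-offset = ℤ-Solver.solve-∀

diag-↓ : ∀ q d → diag (q -ᵈ d) ≡ diag q ↓ d
diag-↓ (x , y) (s , r) = cong (x ℤ.- val s ,_) (shift x y (val s) (val r))
  where
  shift : ∀ x y s r → (y ℤ.- r) ℤ.- (x ℤ.- s) ≡ (y ℤ.- x) ℤ.+ (s ℤ.- r)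
  shift = ℤ-Solver.solve-∀

counts : StepSet → ℕ → Pt → ℚ
counts S n q = walks S n start q

guard-value : ∀ b u v → (b ≡ true → u ≡ v) → (if b then u else 0ℚ) ≡ ind b * v
guard-value true  u v u≡v = trans (u≡v refl) (sym (ℚP.*-identityˡ v))
guard-value false u v _   = sym (ℚP.*-zeroˡ v)

Lhat-at : ∀ S n q → at (Lhat S) n q ≡ ind (L? (diag q)) * counts S n q
Lhat-at S n (x , y) =
  trans (guard-value _ _ _ (λ _ → c≡walks S n x y))
        (cong (λ b → ind ((0ℤ ≤ᵇ x) ∧ b) * counts S n (x , y)) (below-diagonal x y))
  where
  below-diagonal : ∀ x y → (y ≤ᵇ x ℤ.- 1ℤ) ≡ ((y ℤ.- x) ≤ᵇ -1ℤ)
  below-diagonal x y = trans (≤ᵇ-translate y (x ℤ.- 1ℤ) (ℤ.- x)) (cong ((y ℤ.- x) ≤ᵇ_) (minus-one x))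
    where
    minus-one : ∀ x → (x ℤ.- 1ℤ) ℤ.+ ℤ.- x ≡ -1ℤ
    minus-one = ℤ-Solver.solve-∀

-- (Dhat reads c at (x, x), which equals c at (x, y) exactly where it is not cut off.)
Dhat-at : ∀ S n q → at (Dhat S) n q ≡ ind (D? (diag q)) * counts S n q
Dhat-at S n (x , y) =
  trans (guard-value _ _ _ (λ onD → trans (c≡walks S n x x)
                                          (cong (λ w → counts S n (x , w)) (==ℤ-true x y (∧-true-right _ _ onD)))))
        (cong (λ b → ind ((0ℤ ≤ᵇ x) ∧ b) * counts S n (x , y)) (diagonal-test x y))
  where
  diagonal-test : ∀ x y → (x ==ℤ y) ≡ ((y ℤ.- x) ==ℤ 0ℤ)
  diagonal-test x y = does-⇔ (mk⇔ (λ x≡y → trans (cong (ℤ._- x) (sym x≡y)) (ℤP.+-inverseʳ x))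
                                 (λ y-x≡0 → sym (trans (sym (sub-add y x))
                                                       (trans (cong (ℤ._+ x) y-x≡0) (ℤP.+-identityˡ x)))))
                           (x ℤP.≟ y) ((y ℤ.- x) ℤP.≟ 0ℤ)

-- (L0minus reads c at (0, y), which equals c at (x, y) where it is not cut off.)
L0minus-at : ∀ S n q → at (L0minus S) n q ≡ ind (Col? (diag q)) * counts S n q
L0minus-at S n (x , y) with x ℤP.≟ 0ℤ
... | yes refl = trans (guard-value _ _ _ (λ _ → c≡walks S n 0ℤ y))
                       (cong (λ w → ind (w ≤ᵇ -1ℤ) * counts S n (0ℤ , y)) (sym (ℤP.+-identityʳ y)))
... | no _     = sym (ℚP.*-zeroˡ (counts S n (x , y)))

Dhat00-at : ∀ S n q → at (Dhat00 S) n q ≡ ind (O? (diag q)) * counts S n q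
Dhat00-at S n (x , y) with x ℤP.≟ 0ℤ
... | yes refl = trans (guard-value _ _ _ (λ atO → trans (c≡walks S n 0ℤ 0ℤ)
                                                         (cong (λ w → counts S n (0ℤ , w)) (sym (==ℤ-true y 0ℤ atO)))))
                       (cong (λ w → ind (w ==ℤ 0ℤ) * counts S n (0ℤ , y)) (sym (ℤP.+-identityʳ y)))
... | no _     = sym (ℚP.*-zeroˡ (counts S n (x , y)))

source : StepSet → ℕ → Pt → Dir → ℚ
source S k t d = ind (Step S d) * counts S k (t -ᵈ d)

successor : ∀ S k t b → ind b * counts S (suc k) t
  ≡ ind (b ∧ C? (diag t)) * Σᵈ (λ d → ind (C? (diag t ↓ d)) * source S k t d)
successor S k t b = begin
  ind b * walks S (suc k) start t
    ≡⟨ cong (ind b *_) (walks-last S k start t) ⟩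
  ind b * (ind (inC t) * Σᵈ (λ d → ind (Step S d) * walks S k start (t -ᵈ d)))
    ≡⟨ cong₂ (λ x y → ind b * (ind x * y)) (inC-diag t) (Σᵈ-cong inside) ⟩
  ind b * (ind (C? (diag t)) * Σᵈ (λ d → ind (C? (diag t ↓ d)) * source S k t d))
    ≡⟨ ℚP.*-assoc (ind b) (ind (C? (diag t))) _ ⟨
  ind b * ind (C? (diag t)) * Σᵈ (λ d → ind (C? (diag t ↓ d)) * source S k t d)
    ≡⟨ cong (_* Σᵈ (λ d → ind (C? (diag t ↓ d)) * source S k t d)) (ind-∧ b (C? (diag t))) ⟨
  ind (b ∧ C? (diag t)) * Σᵈ (λ d → ind (C? (diag t ↓ d)) * source S k t d)
    ∎
  where
  open ≡-Reasoning
  inside : ∀ d → ind (Step S d) * walks S k start (t -ᵈ d) ≡ ind (C? (diag t ↓ d)) * source S k t d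
  inside d = begin
    ind (Step S d) * walks S k start (t -ᵈ d)
      ≡⟨ cong (ind (Step S d) *_) (walks-inside S k start (t -ᵈ d)) ⟩
    ind (Step S d) * (ind (inC (t -ᵈ d)) * counts S k (t -ᵈ d))
      ≡⟨ cong (λ b → ind (Step S d) * (ind b * counts S k (t -ᵈ d)))
              (trans (inC-diag (t -ᵈ d)) (cong C? (diag-↓ t d))) ⟩
    ind (Step S d) * (ind (C? (diag t ↓ d)) * counts S k (t -ᵈ d))
      ≡⟨ swap-front (ind (Step S d)) (ind (C? (diag t ↓ d))) (counts S k (t -ᵈ d)) ⟩
    ind (C? (diag t ↓ d)) * source S k t d
      ∎
    where
    swap-front : ∀ a b c → a * (b * c) ≡ b * (a * c)
    swap-front = solve-∀ ℚ-ring

-- Steps outside the step set contribute nothing.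
Σᵈ-sources : ∀ S → S z z ≡ false → S m p ≡ false → S p m ≡ false →
  ∀ k t (w : Dir → ℚ) → Σᵈ (λ d → w d * source S k t d) ≡ Σᵃ (λ d → w d * source S k t d)
Σᵈ-sources S hzz hmp hpm k t w = Σᵈ-allowed _ (vanish m p hmp) (vanish z z hzz) (vanish p m hpm)
  where
  vanish : ∀ a b → S a b ≡ false → w (a , b) * source S k t (a , b) ≡ 0ℚ
  vanish a b S≡false rewrite S≡false =
    trans (cong (w (a , b) *_) (ℚP.*-zeroˡ (counts S k (t -ᵈ (a , b))))) (ℚP.*-zeroʳ (w (a , b)))

lhs-weights : ∀ S → S z z ≡ false → S m p ≡ false → S p m ≡ false → ∀ k i j →
  (Khat S · Lhat S) (suc k) i j ≡ Σᵃ (λ d → lhsWeight (diag (target i j)) d * source S k (target i j) d)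
lhs-weights S hzz hmp hpm k i j = begin
  (Khat S · Lhat S) (suc k) i j
    ≡⟨ lhs-coefficient S (Lhat S) k i j ⟩
  Σᵈ (λ d → ind (Step S d) * at (Lhat S) k (t -ᵈ d)) - at (Lhat S) (suc k) t
    ≡⟨ cong₂ _-_ (Σᵈ-cong from-L) (trans (Lhat-at S (suc k) t) (successor S k t (L? P))) ⟩
  Σᵈ (λ d → ind (L? (P ↓ d)) * X d) - ind (L? P ∧ C? P) * Σᵈ (λ d → ind (C? (P ↓ d)) * X d)
    ≡⟨ cong₂ (λ x y → x - ind (L? P ∧ C? P) * y) (Σᵈ-sources S hzz hmp hpm k t (λ d → ind (L? (P ↓ d))))
                                                 (Σᵈ-sources S hzz hmp hpm k t (λ d → ind (C? (P ↓ d)))) ⟩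
  Σᵃ (λ d → ind (L? (P ↓ d)) * X d) - ind (L? P ∧ C? P) * Σᵃ (λ d → ind (C? (P ↓ d)) * X d)
    ≡⟨ trans (as-sum (Σᵃ (λ d → ind (L? (P ↓ d)) * X d)) (ind (L? P ∧ C? P))
                     (Σᵃ (λ d → ind (C? (P ↓ d)) * X d)))
             (sumOver-linear allowed (λ d → ind (L? (P ↓ d)) * X d) (λ d → ind (C? (P ↓ d)) * X d)
                             (ℚ.- ind (L? P ∧ C? P))) ⟩
  Σᵃ (λ d → ind (L? (P ↓ d)) * X d + ℚ.- ind (L? P ∧ C? P) * (ind (C? (P ↓ d)) * X d))
    ≡⟨ sumOver-cong allowed (λ d → collect (ind (L? (P ↓ d))) (L? P ∧ C? P) (C? (P ↓ d)) (X d)) ⟩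
  Σᵃ (λ d → lhsWeight P d * X d)
    ∎
  where
  open ≡-Reasoning
  t : Pt
  t = target i j
  P : ℤ × ℤ
  P = diag t
  X : Dir → ℚ
  X = source S k t
  from-L : ∀ d → ind (Step S d) * at (Lhat S) k (t -ᵈ d) ≡ ind (L? (P ↓ d)) * X d
  from-L d = trans (cong (ind (Step S d) *_)
                         (trans (Lhat-at S k (t -ᵈ d)) (cong (λ Q → ind (L? Q) * counts S k (t -ᵈ d)) (diag-↓ t d))))
                   (swap-front (ind (Step S d)) (ind (L? (P ↓ d))) (counts S k (t -ᵈ d)))
    where
    swap-front : ∀ a b c → a * (b * c) ≡ b * (a * c)
    swap-front = solve-∀ ℚ-ring
  as-sum : ∀ x c y → x - c * y ≡ x + ℚ.- c * y
  as-sum = solve-∀ ℚ-ring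
  collect : ∀ a b c x → a * x + ℚ.- ind b * (ind c * x) ≡ (a - ind (b ∧ c)) * x
  collect a b c x rewrite ind-∧ b c = regroup a (ind b) (ind c) x
    where
    regroup : ∀ a b c x → a * x + ℚ.- b * (c * x) ≡ (a - b * c) * x
    regroup = solve-∀ ℚ-ring

rhs-weights : ∀ S → S z z ≡ false → S m p ≡ false → S p m ≡ false → ∀ k i j →
  RHS S (suc k) i j ≡ Σᵃ (λ d → rhsWeight (diag (target i j)) d * source S k (target i j) d)
rhs-weights S hzz hmp hpm k i j = begin
  RHS S (suc k) i j
    ≡⟨ rhs-coefficient S k i j ⟩
  explicit (L0minus S k (i ℤ.- 0ℤ) (j ℤ.- 0ℤ)) (L0minus S k (i ℤ.- 0ℤ) (j ℤ.- 1ℤ))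
           (Dhat00 S k (i ℤ.- 0ℤ) (j ℤ.- 0ℤ)) (Dhat S (suc k) (i ℤ.- 1ℤ) (j ℤ.- 1ℤ))
           (Dhat S k (i ℤ.- ℤ.+ 2) (j ℤ.- ℤ.+ 2)) (Dhat S k (i ℤ.- 0ℤ) (j ℤ.- 0ℤ))
           (Dhat S k (i ℤ.- 1ℤ) (j ℤ.- 0ℤ)) (Dhat S k (i ℤ.- ℤ.+ 2) (j ℤ.- 1ℤ))
    ≡⟨ explicit-cong (source-at (L0minus S) Col? (L0minus-at S) m m) (source-at (L0minus S) Col? (L0minus-at S) m z)
                     (source-at (Dhat00 S) O? (Dhat00-at S) m m)
                     (trans (Dhat-at S (suc k) t) (trans (successor S k t (D? P))
                            (cong (ind (D? P ∧ C? P) *_) (Σᵈ-sources S hzz hmp hpm k t (λ d → ind (C? (P ↓ d)))))))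
                     (source-at (Dhat S) D? (Dhat-at S) p p) (source-at (Dhat S) D? (Dhat-at S) m m)
                     (source-at (Dhat S) D? (Dhat-at S) z m) (source-at (Dhat S) D? (Dhat-at S) p z) ⟩
  explicit (ind (Col? (P ↓ (m , m))) * f (m , m)) (ind (Col? (P ↓ (m , z))) * f (m , z))
           (ind (O? (P ↓ (m , m))) * f (m , m)) (ind (D? P ∧ C? P) * Σᵃ (λ d → ind (C? (P ↓ d)) * X d))
           (ind (D? (P ↓ (p , p))) * f (p , p)) (ind (D? (P ↓ (m , m))) * f (m , m))
           (ind (D? (P ↓ (z , m))) * f (z , m)) (ind (D? (P ↓ (p , z))) * f (p , z))
    ≡⟨ as-weights (δ S m m) (δ S m z) (δ S z m) (δ S z p) (δ S p z) (δ S p p)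
                  (f (m , m)) (f (m , z)) (f (z , m)) (f (z , p)) (f (p , z)) (f (p , p))
                  (ind (Col? (P ↓ (m , m)))) (ind (Col? (P ↓ (m , z)))) (ind (O? (P ↓ (m , m))))
                  (ind (D? (P ↓ (m , m)))) (ind (D? (P ↓ (z , m)))) (ind (D? (P ↓ (p , z)))) (ind (D? (P ↓ (p , p))))
                  (ind (D? P ∧ C? P) * Σᵃ (λ d → ind (C? (P ↓ d)) * X d)) ⟩
  Σᵃ (λ d → explicitWeight d (P ↓ d) * X d) + ½ * (ind (D? P ∧ C? P) * Σᵃ (λ d → ind (C? (P ↓ d)) * X d))
    ≡⟨ trans (cong (Σᵃ (λ d → explicitWeight d (P ↓ d) * X d) +_)
                   (sym (ℚP.*-assoc ½ (ind (D? P ∧ C? P)) (Σᵃ (λ d → ind (C? (P ↓ d)) * X d)))))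
             (sumOver-linear allowed (λ d → explicitWeight d (P ↓ d) * X d) (λ d → ind (C? (P ↓ d)) * X d)
                             (½ * ind (D? P ∧ C? P))) ⟩
  Σᵃ (λ d → explicitWeight d (P ↓ d) * X d + ½ * ind (D? P ∧ C? P) * (ind (C? (P ↓ d)) * X d))
    ≡⟨ sumOver-cong allowed (λ d → collect (explicitWeight d (P ↓ d)) (D? P ∧ C? P) (C? (P ↓ d)) (X d)) ⟩
  Σᵃ (λ d → rhsWeight P d * X d)
    ∎
  where
  open ≡-Reasoning
  t : Pt
  t = target i j
  P : ℤ × ℤ
  P = diag t
  X : Dir → ℚ
  X = source S k t
  f : Dir → ℚ
  f d = counts S k (t -ᵈ d)
  explicit : (L₁ L₂ O G D₁ D₂ D₃ D₄ : ℚ) → ℚ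
  explicit L₁ L₂ O G D₁ D₂ D₃ D₄ =
      δ S m m * L₁ + δ S m z * L₂ + ½ * δ S m m * O + ½ * G
    - ½ * δ S p p * D₁ - ½ * δ S m m * D₂ - δ S z m * D₃ - δ S p z * D₄
  explicit-cong : ∀ {L₁ L₂ O G D₁ D₂ D₃ D₄ L₁′ L₂′ O′ G′ D₁′ D₂′ D₃′ D₄′} →
    L₁ ≡ L₁′ → L₂ ≡ L₂′ → O ≡ O′ → G ≡ G′ → D₁ ≡ D₁′ → D₂ ≡ D₂′ → D₃ ≡ D₃′ → D₄ ≡ D₄′ →
    explicit L₁ L₂ O G D₁ D₂ D₃ D₄ ≡ explicit L₁′ L₂′ O′ G′ D₁′ D₂′ D₃′ D₄′
  explicit-cong refl refl refl refl refl refl refl refl = refl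
  source-at : ∀ (F : Series) (R : ℤ × ℤ → Bool) → (∀ n q → at F n q ≡ ind (R (diag q)) * counts S n q) →
    ∀ s r → F k (i ℤ.- (1ℤ ℤ.+ val s)) (j ℤ.- (1ℤ ℤ.+ val r)) ≡ ind (R (P ↓ (s , r))) * f (s , r)
  source-at F R F-at s r = begin
    F k (i ℤ.- (1ℤ ℤ.+ val s)) (j ℤ.- (1ℤ ℤ.+ val r))
      ≡⟨ cong₂ (F k) (sub-sub i (val s)) (sub-sub j (val r)) ⟨
    at F k (t -ᵈ (s , r))
      ≡⟨ F-at k (t -ᵈ (s , r)) ⟩
    ind (R (diag (t -ᵈ (s , r)))) * f (s , r)
      ≡⟨ cong (λ Q → ind (R Q) * f (s , r)) (diag-↓ t (s , r)) ⟩
    ind (R (P ↓ (s , r))) * f (s , r)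
      ∎
    where
    sub-sub : ∀ x v → (x ℤ.- 1ℤ) ℤ.- v ≡ x ℤ.- (1ℤ ℤ.+ v)
    sub-sub = ℤ-Solver.solve-∀
  as-weights : ∀ a b c e d g f₁ f₂ f₃ f₄ f₅ f₆ C₁ C₂ O₁ D₁ D₃ D₅ D₆ G →
      a * (C₁ * f₁) + b * (C₂ * f₂) + ½ * a * (O₁ * f₁) + ½ * G
    - ½ * g * (D₆ * f₆) - ½ * a * (D₁ * f₁) - c * (D₃ * f₃) - d * (D₅ * f₅)
    ≡ ((C₁ + ½ * O₁ - ½ * D₁) * (a * f₁) + (C₂ * (b * f₂) + ((ℚ.- D₃) * (c * f₃) + (0ℚ * (e * f₄)
      + ((ℚ.- D₅) * (d * f₅) + ((ℚ.- (½ * D₆)) * (g * f₆) + 0ℚ)))))) + ½ * G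
  as-weights = solve-∀ ℚ-ring
  collect : ∀ a b c x → a * x + ½ * ind b * (ind c * x) ≡ (a + ½ * ind (b ∧ c)) * x
  collect a b c x rewrite ind-∧ b c = regroup a (ind b) (ind c) x
    where
    regroup : ∀ a b c x → a * x + ½ * b * (c * x) ≡ (a + ½ * (b * c)) * x
    regroup = solve-∀ ℚ-ring

on-diagonal : ∀ x y → D? (diag (x , y)) ≡ true → Σ ℕ (λ n → x ≡ ℤ.+ n × y ≡ x)
on-diagonal (ℤ.+ n) y onD = n , refl , y≡x
  where
  y≡x : y ≡ ℤ.+ n
  y≡x = trans (sym (sub-add y (ℤ.+ n)))
              (trans (cong (ℤ._+ (ℤ.+ n)) (==ℤ-true (y ℤ.- (ℤ.+ n)) 0ℤ (∧-true-right _ _ onD)))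
                     (ℤP.+-identityˡ (ℤ.+ n)))
on-diagonal -[1+ n ] y ()

-- The two weighted sums agree: off the diagonal the weights coincide, on the
-- diagonal the difference cancels because the counts are symmetric.
weights-balance : ∀ S → (∀ a b → S a b ≡ S b a) → ∀ k t →
  Σᵃ (λ d → lhsWeight (diag t) d * source S k t d) ≡ Σᵃ (λ d → rhsWeight (diag t) d * source S k t d)
weights-balance S sym-S k (x , y) = by-cases (D? (diag (x , y))) refl
  where
  by-cases : ∀ b → D? (diag (x , y)) ≡ b →
    Σᵃ (λ d → lhsWeight (diag (x , y)) d * source S k (x , y) d)
      ≡ Σᵃ (λ d → rhsWeight (diag (x , y)) d * source S k (x , y) d)
  by-cases false offD = sumOver-weights allowed (lhsWeight (diag (x , y))) (rhsWeight (diag (x , y)))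
                                        (source S k (x , y)) (weights-off-diagonal x (y ℤ.- x) offD)
  by-cases true  onD with on-diagonal x y onD
  ... | n , refl , refl = begin
    Σᵃ (λ d → lhsWeight (diag (ℤ.+ n , ℤ.+ n)) d * X d)
      ≡⟨ cong (λ P → Σᵃ (λ d → lhsWeight P d * X d)) diag≡ ⟩
    Σᵃ (λ d → lhsWeight (ℤ.+ n , 0ℤ) d * X d)
      ≡⟨ sumOver-weights allowed (lhsWeight (ℤ.+ n , 0ℤ)) diagonalLhs X (proj₁ (weights-on-diagonal n)) ⟩
    Σᵃ (λ d → diagonalLhs d * X d)
      ≡⟨ diagonal-balance X (transposed m z) (transposed z p) ⟩
    Σᵃ (λ d → diagonalRhs d * X d)
      ≡⟨ sumOver-weights allowed (rhsWeight (ℤ.+ n , 0ℤ)) diagonalRhs X (proj₂ (weights-on-diagonal n)) ⟨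
    Σᵃ (λ d → rhsWeight (ℤ.+ n , 0ℤ) d * X d)
      ≡⟨ cong (λ P → Σᵃ (λ d → rhsWeight P d * X d)) diag≡ ⟨
    Σᵃ (λ d → rhsWeight (diag (ℤ.+ n , ℤ.+ n)) d * X d)
      ∎
    where
    open ≡-Reasoning
    X : Dir → ℚ
    X = source S k (ℤ.+ n , ℤ.+ n)
    diag≡ : diag (ℤ.+ n , ℤ.+ n) ≡ (ℤ.+ n , 0ℤ)
    diag≡ = cong ((ℤ.+ n) ,_) (ℤP.+-inverseʳ (ℤ.+ n))
    -- from a diagonal point, a step and its transpose lead to transposed sources
    transposed : ∀ a b → X (a , b) ≡ X (b , a)
    transposed a b =
      cong₂ (λ s c → ind s * c) (sym-S a b) (sym (walks-swap S sym-S k start ((ℤ.+ n , ℤ.+ n) -ᵈ (a , b))))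

counts-zero : ∀ S q → counts S 0 q ≡ at oneS 0 q
counts-zero S (x , y) = trans (walks-zero S start (x , y)) (cong ind (cong₂ _∧_ (==ℤ-sym 0ℤ x) (==ℤ-sym 0ℤ y)))

at-origin : ∀ (R : ℤ × ℤ → Bool) q → ind (R (diag q)) * at oneS 0 q ≡ ind (R (0ℤ , 0ℤ)) * at oneS 0 q
at-origin R (x , y) with x ℤP.≟ 0ℤ | y ℤP.≟ 0ℤ
... | yes refl | yes refl = refl
... | yes refl | no _     = trans (ℚP.*-zeroʳ (ind (R (diag (x , y))))) (sym (ℚP.*-zeroʳ (ind (R (0ℤ , 0ℤ)))))
... | no _     | _        = trans (ℚP.*-zeroʳ (ind (R (diag (x , y))))) (sym (ℚP.*-zeroʳ (ind (R (0ℤ , 0ℤ)))))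

-- In degree 0 the left-hand side vanishes, since Lhat has no constant term ...
degree-zero-lhs : ∀ S i j → (Khat S · Lhat S) 0 i j ≡ 0ℚ
degree-zero-lhs S i j = begin
  (Khat S · Lhat S) 0 i j
    ≡⟨ lhs-coefficient-zero S (Lhat S) i j ⟩
  ℚ.- at (Lhat S) 0 t
    ≡⟨ cong ℚ.-_ (trans (Lhat-at S 0 t) (trans (cong (ind (L? (diag t)) *_) (counts-zero S t)) (at-origin L? t))) ⟩
  ℚ.- (0ℚ * at oneS 0 t)
    ≡⟨ cong ℚ.-_ (ℚP.*-zeroˡ (at oneS 0 t)) ⟩
  0ℚ
    ∎
  where
  open ≡-Reasoning
  t : Pt
  t = target i j

-- ... and so does the right-hand side, as ½ D̂(0,0) cancels -½ x y.
degree-zero-rhs : ∀ S i j → RHS S 0 i j ≡ 0ℚ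
degree-zero-rhs S i j = begin
  RHS S 0 i j
    ≡⟨ rhs-coefficient-zero S i j ⟩
  ½ * at (Dhat S) 0 t - ½ * at oneS 0 t
    ≡⟨ cong (λ x → ½ * x - ½ * at oneS 0 t)
            (trans (Dhat-at S 0 t) (trans (cong (ind (D? (diag t)) *_) (counts-zero S t)) (at-origin D? t))) ⟩
  ½ * (1ℚ * at oneS 0 t) - ½ * at oneS 0 t
    ≡⟨ cancel (at oneS 0 t) ⟩
  0ℚ
    ∎
  where
  open ≡-Reasoning
  t : Pt
  t = target i j
  cancel : ∀ x → ½ * (1ℚ * x) - ½ * x ≡ 0ℚ
  cancel = solve-∀ ℚ-ring

symmetric : ∀ S → Symmetric S → ∀ a b → S a b ≡ S b a
symmetric S sym-S a b with S a b in ab | S b a in ba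
... | true  | true  = refl
... | false | false = refl
... | true  | false = trans (sym (sym-S a b ab)) ba
... | false | true  = trans (sym ab) (sym-S b a ba)

lemma1 : (S : StepSet) → S z z ≡ false → Symmetric S →
         S m p ≡ false → S p m ≡ false →
         ∀ n i j → (Khat S · Lhat S) n i j ≡ RHS S n i j
lemma1 S hzz sym-S hmp hpm zero    i j = trans (degree-zero-lhs S i j) (sym (degree-zero-rhs S i j))
lemma1 S hzz sym-S hmp hpm (suc k) i j = begin
  (Khat S · Lhat S) (suc k) i j
    ≡⟨ lhs-weights S hzz hmp hpm k i j ⟩
  Σᵃ (λ d → lhsWeight (diag t) d * source S k t d)
    ≡⟨ weights-balance S (symmetric S sym-S) k t ⟩
  Σᵃ (λ d → rhsWeight (diag t) d * source S k t d)
    ≡⟨ rhs-weights S hzz hmp hpm k i j ⟨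
  RHS S (suc k) i j
    ∎
  where
  open ≡-Reasoning
  t : Pt
  t = target i j
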